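{- For every finite signed set $S$ of nonzero integers there exist $n\in\mathbb{N}$ and $w\in\mathfrak{S}_n^B$ whose pinnacle set is $S$; that is, $S\in\mathsf{APS}^B_n$ for some $n$.
   Context: A signed set is a set $I$ such that $x\in I$ implies $-x\notin I$. For $n\in\mathbb{N}$, $[n]=\{1,\dots,n\}$, $\pm[n]=[n]\cup-[n]$, and $\mathfrak{S}_n^B$ is the group of bijections $w:\pm[n]\to\pm[n]$ with $w(-i)=-w(i)$, written in one-line notation $w(1)\cdots w(n)$. A pinnacle of $w$ is a value $w(i)$ with $2\le i\le n-1$ and $w(i-1)<w(i)>w(i+1)$; the pinnacle set of $w$ is the set of its pinnacles. $\mathsf{APS}^B_n$ is the set of pinnacle sets of elements of $\mathfrak{S}_n^B$. -}

module Defs where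

open import Data.Nat using (ℕ; suc; _≤_; _<_)
open import Data.Fin using (Fin; toℕ)
open import Data.Integer as ℤ using (ℤ; -_; ∣_∣)
open import Data.List using (List)
open import Data.List.Membership.Propositional using (_∈_; _∉_)
open import Data.Product using (Σ; ∃-syntax; _×_)
open import Relation.Binary.PropositionalEquality using (_≡_; _≢_)
open import Relation.Nullary using (¬_)

-- A signed permutation w ∈ 𝔖ᴮₙ is determined by its one-line notation
-- w(1) ⋯ w(n); here indexed by Fin n (position i+1 ↦ index i).
-- The map ±[n] → ±[n] with w(-i) = -w(i) is a bijection exactly when
-- every entry lies in ±[n] and i ↦ |w(i)| is injective on [n].
record SignedPerm (n : ℕ) : Set where
  field
    oneLine  : Fin n → ℤ
    nonzero  : ∀ i → oneLine i ≢ ℤ.0ℤ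
    bounded  : ∀ i → ∣ oneLine i ∣ ≤ n
    absInj   : ∀ i j → ∣ oneLine i ∣ ≡ ∣ oneLine j ∣ → i ≡ j
open SignedPerm public

-- x is a pinnacle of w: x = w(i) for some position i with 2 ≤ i ≤ n-1
-- and w(i-1) < w(i) > w(i+1).  Using 0-based indices a,b,c with
-- toℕ b = suc (toℕ a) and toℕ c = suc (toℕ b).
IsPinnacle : {n : ℕ} → SignedPerm n → ℤ → Set
IsPinnacle {n} w x =
  ∃[ a ] ∃[ b ] ∃[ c ]
    (toℕ b ≡ suc (toℕ a)) × (toℕ c ≡ suc (toℕ b)) ×
    (oneLine w b ≡ x) × (oneLine w a ℤ.< x) × (oneLine w c ℤ.< x)

PinnacleSetIs : {n : ℕ} → SignedPerm n → List ℤ → Set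
PinnacleSetIs w S = ∀ x → (x ∈ S → IsPinnacle w x) × (IsPinnacle w x → x ∈ S)

Signed : List ℤ → Set
Signed S = ∀ x → x ∈ S → - x ∉ S

AllNonzero : List ℤ → Set
AllNonzero S = ∀ x → x ∈ S → x ≢ ℤ.0ℤ

module Submission where

-- Let N bound the absolute values in S and, for 1 ≤ j ≤ N, let s_j be the element of S of
-- absolute value j when there is one (S being signed, there is at most one). Take the word
--   −(2N+1), [s_N], −2N, [s_{N−1}], −(2N−1), …, [s_1], −(N+1),
-- followed by the −j with ±j ∉ S in increasing order. Deleting the s_j leaves an increasing
-- sequence and every s_j exceeds both of its neighbours, so the pinnacles are exactly the s_j;
-- and the absolute values of the entries run through 1, …, 2N+1 once each.

open import Defs
open import Data.Nat using (ℕ)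
open import Data.Integer using (ℤ)
open import Data.List using (List)
open import Data.Product using (Σ; ∃-syntax; _×_)

open import Data.Nat as ℕ using (zero; suc; _+_; z<s)
import Data.Nat.Properties as ℕ
open import Data.Integer using (0ℤ; +_; +[1+_]; -[1+_]; ∣_∣; _<_; _◃_; -<-; -<+; _≟_)
open import Data.Integer.Properties using (<-trans; <-asym; abs-◃)
open import Data.Sign using (Sign)
open import Data.Fin using (Fin; toℕ; zero; suc)
open import Data.Maybe as Maybe using (Maybe; just; nothing)
open import Data.Maybe.Relation.Unary.All as MaybeAll using (just; nothing)
open import Data.List using ([]; _∷_; _++_; map; concatMap; catMaybes; mapMaybe; lookup; length; applyDownFrom)
open import Data.List.Properties using (length-map; length-applyDownFrom; map-++; catMaybes-++; ++-identityʳ)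
open import Data.List.Extrema.Nat using (max; xs≤max)
open import Data.List.Relation.Unary.All as All using (All; []; _∷_)
import Data.List.Relation.Unary.All.Properties as All
open import Data.List.Relation.Unary.Any using (here; there)
open import Data.List.Relation.Unary.Linked using (Linked; [-]; _∷_)
open import Data.List.Relation.Unary.Unique.Propositional using (Unique; _∷_)
import Data.List.Relation.Unary.Unique.Propositional.Properties as Unique
open import Data.List.Relation.Binary.Permutation.Propositional
  using (_↭_; ↭-sym; ↭-trans; ↭-prep; ↭-refl; ↭⇒↭ₛ; module PermutationReasoning)
open import Data.List.Relation.Binary.Permutation.Propositional.Properties
  using (Any-resp-↭; ↭-length; shift; shifts; map⁺; ++⁺ˡ)
import Data.List.Relation.Binary.Permutation.Setoid.Properties as Setoid↭
open import Data.List.Membership.Propositional using (_∈_; _∉_)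
open import Data.List.Membership.Propositional.Properties using (∈-map⁺; ∈-lookup; ∈-applyDownFrom⁻)
open import Data.List.Membership.DecPropositional _≟_ using (_∈?_)
open import Data.Product using (_,_)
open import Data.Sum using (inj₁; inj₂)
open import Data.Empty using (⊥-elim)
open import Relation.Nullary using (yes; no; contradiction)
open import Relation.Binary.PropositionalEquality
  using (_≡_; _≢_; refl; sym; trans; cong; cong₂; subst; setoid; module ≡-Reasoning)

data Pinnacle : List ℤ → ℤ → Set where
  here  : ∀ {a b c r} → a < b → c < b → Pinnacle (a ∷ b ∷ c ∷ r) b
  there : ∀ {a r x} → Pinnacle r x → Pinnacle (a ∷ r) x

PinnacleOf : {n : ℕ} → (Fin n → ℤ) → ℤ → Set
PinnacleOf f x = ∃[ a ] ∃[ b ] ∃[ c ]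
  (toℕ b ≡ suc (toℕ a)) × (toℕ c ≡ suc (toℕ b)) × (f b ≡ x) × (f a < x) × (f c < x)

Pinnacle⇒PinnacleOf-lookup : ∀ {L x} → Pinnacle L x → PinnacleOf (lookup L) x
Pinnacle⇒PinnacleOf-lookup (here a<b c<b) =
  zero , suc zero , suc (suc zero) , refl , refl , refl , a<b , c<b
Pinnacle⇒PinnacleOf-lookup (there p)
  with a , b , c , ab , bc , fb , fa , fc ← Pinnacle⇒PinnacleOf-lookup p =
  suc a , suc b , suc c , cong suc ab , cong suc bc , fb , fa , fc

PinnacleOf-lookup⇒Pinnacle : ∀ L {x} → PinnacleOf (lookup L) x → Pinnacle L x
PinnacleOf-lookup⇒Pinnacle (_ ∷ _ ∷ _ ∷ _)
  (zero , suc zero , suc (suc zero) , refl , refl , refl , fa , fc) = here fa fc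
PinnacleOf-lookup⇒Pinnacle (_ ∷ _ ∷ []) (zero , suc zero , suc zero , refl , () , _)
PinnacleOf-lookup⇒Pinnacle (_ ∷ L) (suc a , suc b , suc c , ab , bc , fb , fa , fc) =
  there (PinnacleOf-lookup⇒Pinnacle L
          (a , b , c , ℕ.suc-injective ab , ℕ.suc-injective bc , fb , fa , fc))

lookup-injective : ∀ {A B : Set} (f : A → B) {xs : List A} → Unique (map f xs) →
                   ∀ i j → f (lookup xs i) ≡ f (lookup xs j) → i ≡ j
lookup-injective f {_ ∷ _} _          zero    zero    _  = refl
lookup-injective f {_ ∷ _} (fx∉ ∷ _)  zero    (suc j) eq = ⊥-elim (All.lookup fx∉ (∈-map⁺ f (∈-lookup j)) eq)
lookup-injective f {_ ∷ _} (fx∉ ∷ _)  (suc i) zero    eq = ⊥-elim (All.lookup fx∉ (∈-map⁺ f (∈-lookup i)) (sym eq))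
lookup-injective f {_ ∷ _} (_ ∷ uniq) (suc i) (suc j) eq = cong suc (lookup-injective f uniq i j eq)

module _ (L : List ℤ) {n : ℕ} (∣L∣↭ : map ∣_∣ L ↭ applyDownFrom suc n) where

  private
    ∣lookup∣≡1+ : ∀ i → ∃[ k ] k ℕ.< n × ∣ lookup L i ∣ ≡ suc k
    ∣lookup∣≡1+ i = ∈-applyDownFrom⁻ suc (Any-resp-↭ ∣L∣↭ (∈-map⁺ ∣_∣ (∈-lookup i)))

    n≡length : n ≡ length L
    n≡length = trans (sym (length-applyDownFrom suc n))
                     (trans (sym (↭-length ∣L∣↭)) (length-map ∣_∣ L))

    lookup≢0 : ∀ i → lookup L i ≢ 0ℤ
    lookup≢0 i x≡0 with _ , _ , ∣x∣≡1+k ← ∣lookup∣≡1+ i =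
      ℕ.0≢1+n (trans (sym (cong ∣_∣ x≡0)) ∣x∣≡1+k)

    ∣lookup∣≤length : ∀ i → ∣ lookup L i ∣ ℕ.≤ length L
    ∣lookup∣≤length i with _ , k<n , ∣x∣≡1+k ← ∣lookup∣≡1+ i =
      ℕ.≤-trans (ℕ.≤-reflexive ∣x∣≡1+k) (ℕ.≤-trans k<n (ℕ.≤-reflexive n≡length))

    unique : Unique (map ∣_∣ L)
    unique = Setoid↭.Unique-resp-↭ (setoid ℕ) (↭⇒↭ₛ (↭-sym ∣L∣↭))
               (Unique.applyDownFrom⁺₁ suc n (λ j<i _ eq → ℕ.<⇒≢ j<i (sym (ℕ.suc-injective eq))))

  signedPerm : SignedPerm (length L)
  signedPerm = record
    { oneLine = lookup L
    ; nonzero = lookup≢0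
    ; bounded = ∣lookup∣≤length
    ; absInj  = lookup-injective ∣_∣ unique
    }

record Block : Set where
  constructor block
  field
    top    : Maybe ℤ
    bottom : ℤ
open Block

blockList : Block → List ℤ
blockList (block nothing  v) = v ∷ []
blockList (block (just p) v) = p ∷ v ∷ []

peaks : List Block → List ℤ
peaks = mapMaybe top

flatten : List Block → List ℤ
flatten = concatMap blockList

TopAboveBottom : Block → Set
TopAboveBottom b = MaybeAll.All (bottom b <_) (top b)

zigzag-above : ∀ {v bs} → Linked _<_ (v ∷ map bottom bs) → All TopAboveBottom bs →
               All (v <_) (flatten bs)
zigzag-above {bs = []} _ [] = []
zigzag-above {bs = block nothing u ∷ _} (v<u ∷ asc) (nothing ∷ tops) =
  v<u ∷ All.map (<-trans v<u) (zigzag-above asc tops)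
zigzag-above {bs = block (just p) u ∷ _} (v<u ∷ asc) (just u<p ∷ tops) =
  <-trans v<u u<p ∷ v<u ∷ All.map (<-trans v<u) (zigzag-above asc tops)

Pinnacle-∷⁻ : ∀ {a b r x} → All (b <_) r → Pinnacle (a ∷ b ∷ r) x → Pinnacle (b ∷ r) x
Pinnacle-∷⁻ (b<c ∷ _) (here _ c<b) = contradiction c<b (<-asym b<c)
Pinnacle-∷⁻ _         (there p)    = p

zigzag-pinnacle⁻ : ∀ {v bs x} → Linked _<_ (v ∷ map bottom bs) → All TopAboveBottom bs →
                   Pinnacle (v ∷ flatten bs) x → x ∈ peaks bs
zigzag-pinnacle⁻ {bs = []} _ _ (there ())
zigzag-pinnacle⁻ {bs = block nothing u ∷ _} (_ ∷ asc) (nothing ∷ tops) p =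
  zigzag-pinnacle⁻ asc tops (Pinnacle-∷⁻ (zigzag-above asc tops) p)
zigzag-pinnacle⁻ {bs = block (just _) u ∷ _} _ _ (here _ _) = here refl
zigzag-pinnacle⁻ {bs = block (just _) u ∷ _} (_ ∷ asc) (_ ∷ tops) (there p) =
  there (zigzag-pinnacle⁻ asc tops (Pinnacle-∷⁻ (zigzag-above asc tops) p))

zigzag-pinnacle⁺ : ∀ {v bs x} → Linked _<_ (v ∷ map bottom bs) → All TopAboveBottom bs →
                   x ∈ peaks bs → Pinnacle (v ∷ flatten bs) x
zigzag-pinnacle⁺ {bs = block nothing u ∷ _} (_ ∷ asc) (_ ∷ tops) x∈ =
  there (zigzag-pinnacle⁺ asc tops x∈)
zigzag-pinnacle⁺ {bs = block (just _) u ∷ _} (v<u ∷ _) (just u<p ∷ _) (here refl) =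
  here (<-trans v<u u<p) u<p
zigzag-pinnacle⁺ {bs = block (just _) u ∷ _} (_ ∷ asc) (_ ∷ tops) (there x∈) =
  there (there (zigzag-pinnacle⁺ asc tops x∈))

flatten-↭ : ∀ bs → flatten bs ↭ peaks bs ++ map bottom bs
flatten-↭ [] = ↭-refl
flatten-↭ (block nothing u ∷ bs) =
  ↭-trans (↭-prep u (flatten-↭ bs)) (↭-sym (shift u (peaks bs) (map bottom bs)))
flatten-↭ (block (just p) u ∷ bs) =
  ↭-prep p (↭-trans (↭-prep u (flatten-↭ bs)) (↭-sym (shift u (peaks bs) (map bottom bs))))

applyDownFrom-+ : ∀ {A : Set} (f : ℕ → A) m n →
                  applyDownFrom f (m + n) ≡ applyDownFrom (λ k → f (k + n)) m ++ applyDownFrom f n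
applyDownFrom-+ f zero    n = refl
applyDownFrom-+ f (suc m) n = cong (f (m + n) ∷_) (applyDownFrom-+ f m n)

module ZigzagWord (N : ℕ) (choice : ℕ → Maybe Sign) where

  peakOf : ℕ → Maybe ℤ
  peakOf j = Maybe.map (_◃ j) (choice j)

  mainBlocks : ℕ → List Block
  mainBlocks zero    = []
  mainBlocks (suc k) = block (peakOf (suc k)) -[1+ k + N ] ∷ mainBlocks k

  spareBlock : ℕ → Maybe Sign → List Block
  spareBlock k nothing  = block nothing -[1+ k ] ∷ []
  spareBlock k (just _) = []

  spareBlocks : ℕ → List Block
  spareBlocks zero    = []
  spareBlocks (suc k) = spareBlock k (choice (suc k)) ++ spareBlocks k

  blocks : List Block
  blocks = mainBlocks N ++ spareBlocks N

  word : List ℤ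
  word = -[1+ N + N ] ∷ flatten blocks

  spare-ascending : ∀ {t} m → m ℕ.≤ t → Linked _<_ (-[1+ t ] ∷ map bottom (spareBlocks m))
  spare-ascending zero    _ = [-]
  spare-ascending (suc k) k<t with choice (suc k)
  ... | nothing = -<- k<t ∷ spare-ascending k ℕ.≤-refl
  ... | just _  = spare-ascending k (ℕ.<⇒≤ k<t)

  bottoms-ascending : ∀ m → Linked _<_ (-[1+ m + N ] ∷ map bottom (mainBlocks m ++ spareBlocks N))
  bottoms-ascending zero    = spare-ascending N ℕ.≤-refl
  bottoms-ascending (suc k) = -<- (ℕ.n<1+n (k + N)) ∷ bottoms-ascending k

  valley<peak : ∀ s {k} → k ℕ.< N → -[1+ k + N ] < s ◃ suc k
  valley<peak Sign.+ _   = -<+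
  valley<peak Sign.- k<N = -<- (ℕ.m<m+n _ (ℕ.<-≤-trans z<s k<N))

  main-tops : ∀ m → m ℕ.≤ N → All TopAboveBottom (mainBlocks m)
  main-tops zero    _   = []
  main-tops (suc k) k<N with choice (suc k)
  ... | nothing = nothing ∷ main-tops k (ℕ.<⇒≤ k<N)
  ... | just s  = just (valley<peak s k<N) ∷ main-tops k (ℕ.<⇒≤ k<N)

  spare-tops : ∀ m → All TopAboveBottom (spareBlocks m)
  spare-tops zero    = []
  spare-tops (suc k) with choice (suc k)
  ... | nothing = nothing ∷ spare-tops k
  ... | just _  = spare-tops k

  tops : All TopAboveBottom blocks
  tops = All.++⁺ (main-tops N ℕ.≤-refl) (spare-tops N)

  ∣main-bottoms∣ : ∀ m → map ∣_∣ (map bottom (mainBlocks m)) ≡ applyDownFrom (λ k → suc (k + N)) m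
  ∣main-bottoms∣ zero    = refl
  ∣main-bottoms∣ (suc k) = cong (suc (k + N) ∷_) (∣main-bottoms∣ k)

  ∣peaks∣++∣spare∣↭ : ∀ m → map ∣_∣ (peaks (mainBlocks m)) ++ map ∣_∣ (map bottom (spareBlocks m))
                              ↭ applyDownFrom suc m
  ∣peaks∣++∣spare∣↭ zero    = ↭-refl
  ∣peaks∣++∣spare∣↭ (suc k) with choice (suc k)
  ... | just s  rewrite abs-◃ s (suc k) = ↭-prep (suc k) (∣peaks∣++∣spare∣↭ k)
  ... | nothing = ↭-trans (shift (suc k) (map ∣_∣ (peaks (mainBlocks k))) _)
                          (↭-prep (suc k) (∣peaks∣++∣spare∣↭ k))

  spare-peaks : ∀ m → peaks (spareBlocks m) ≡ []
  spare-peaks zero    = refl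
  spare-peaks (suc k) with choice (suc k)
  ... | nothing = spare-peaks k
  ... | just _  = spare-peaks k

  peaks-blocks : peaks blocks ≡ peaks (mainBlocks N)
  peaks-blocks = begin
    catMaybes (map top (mainBlocks N ++ spareBlocks N))
      ≡⟨ cong catMaybes (map-++ top (mainBlocks N) (spareBlocks N)) ⟩
    catMaybes (map top (mainBlocks N) ++ map top (spareBlocks N))
      ≡⟨ catMaybes-++ (map top (mainBlocks N)) (map top (spareBlocks N)) ⟩
    peaks (mainBlocks N) ++ peaks (spareBlocks N)
      ≡⟨ cong (peaks (mainBlocks N) ++_) (spare-peaks N) ⟩
    peaks (mainBlocks N) ++ []
      ≡⟨ ++-identityʳ _ ⟩
    peaks (mainBlocks N) ∎
    where open ≡-Reasoning

  ∣word∣↭ : map ∣_∣ word ↭ applyDownFrom suc (suc (N + N))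
  ∣word∣↭ = ↭-prep (suc (N + N)) (begin
    map ∣_∣ (flatten blocks)  ↭⟨ map⁺ ∣_∣ (flatten-↭ blocks) ⟩
    map ∣_∣ (peaks blocks ++ map bottom blocks)  ≡⟨ split ⟩
    chosen ++ valleys ++ spare  ↭⟨ shifts chosen valleys ⟩
    valleys ++ chosen ++ spare  ↭⟨ ++⁺ˡ valleys (∣peaks∣++∣spare∣↭ N) ⟩
    valleys ++ applyDownFrom suc N  ≡⟨ sym (applyDownFrom-+ suc N N) ⟩
    applyDownFrom suc (N + N)  ∎)
    where
    open PermutationReasoning
    chosen valleys spare : List ℕ
    chosen  = map ∣_∣ (peaks (mainBlocks N))
    valleys = applyDownFrom (λ k → suc (k + N)) N
    spare   = map ∣_∣ (map bottom (spareBlocks N))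
    split : map ∣_∣ (peaks blocks ++ map bottom blocks) ≡ chosen ++ valleys ++ spare
    split = E.begin
      map ∣_∣ (peaks blocks ++ map bottom blocks)
        E.≡⟨ map-++ ∣_∣ (peaks blocks) (map bottom blocks) ⟩
      map ∣_∣ (peaks blocks) ++ map ∣_∣ (map bottom (mainBlocks N ++ spareBlocks N))
        E.≡⟨ cong₂ (λ ps bs → map ∣_∣ ps ++ map ∣_∣ bs)
                   peaks-blocks (map-++ bottom (mainBlocks N) (spareBlocks N)) ⟩
      chosen ++ map ∣_∣ (map bottom (mainBlocks N) ++ map bottom (spareBlocks N))
        E.≡⟨ cong (chosen ++_) (map-++ ∣_∣ (map bottom (mainBlocks N)) (map bottom (spareBlocks N))) ⟩
      chosen ++ map ∣_∣ (map bottom (mainBlocks N)) ++ spare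
        E.≡⟨ cong (λ vs → chosen ++ vs ++ spare) (∣main-bottoms∣ N) ⟩
      chosen ++ valleys ++ spare E.∎
      where module E = ≡-Reasoning

  chosen-peak⁻ : ∀ m {x} → x ∈ peaks (mainBlocks m) → ∃[ j ] ∃[ s ] choice j ≡ just s × s ◃ j ≡ x
  chosen-peak⁻ (suc k) x∈ with choice (suc k) in eq
  chosen-peak⁻ (suc k) (here refl) | just s  = suc k , s , eq , refl
  chosen-peak⁻ (suc k) (there x∈)  | just _  = chosen-peak⁻ k x∈
  chosen-peak⁻ (suc k) x∈          | nothing = chosen-peak⁻ k x∈

  chosen-peak⁺ : ∀ m {k s} → k ℕ.< m → choice (suc k) ≡ just s → s ◃ suc k ∈ peaks (mainBlocks m)
  chosen-peak⁺ (suc m) k<1+m eq with ℕ.m<1+n⇒m<n∨m≡n k<1+m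
  ... | inj₂ refl rewrite eq = here refl
  ... | inj₁ k<m with choice (suc m)
  ...   | just _  = there (chosen-peak⁺ m k<m eq)
  ...   | nothing = chosen-peak⁺ m k<m eq

  pinnacle⇒chosen : ∀ {x} → Pinnacle word x → ∃[ j ] ∃[ s ] choice j ≡ just s × s ◃ j ≡ x
  pinnacle⇒chosen p =
    chosen-peak⁻ N (subst (_ ∈_) peaks-blocks (zigzag-pinnacle⁻ (bottoms-ascending N) tops p))

  chosen⇒pinnacle : ∀ {k s} → k ℕ.< N → choice (suc k) ≡ just s → Pinnacle word (s ◃ suc k)
  chosen⇒pinnacle k<N eq =
    zigzag-pinnacle⁺ (bottoms-ascending N) tops (subst (_ ∈_) (sym peaks-blocks) (chosen-peak⁺ N k<N eq))

signIn : List ℤ → ℕ → Maybe Sign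
signIn S j with (Sign.+ ◃ j) ∈? S | (Sign.- ◃ j) ∈? S
... | yes _ | _     = just Sign.+
... | no _  | yes _ = just Sign.-
... | no _  | no _  = nothing

signIn-sound : ∀ S j {s} → signIn S j ≡ just s → s ◃ j ∈ S
signIn-sound S j eq with (Sign.+ ◃ j) ∈? S | (Sign.- ◃ j) ∈? S
signIn-sound S j refl | yes +j∈S | _        = +j∈S
signIn-sound S j refl | no _     | yes -j∈S = -j∈S

signIn-pos : ∀ {S j} → (Sign.+ ◃ j) ∈ S → signIn S j ≡ just Sign.+
signIn-pos {S} {j} +j∈S with (Sign.+ ◃ j) ∈? S
... | yes _   = refl
... | no +j∉S = contradiction +j∈S +j∉S

signIn-neg : ∀ {S j} → (Sign.+ ◃ j) ∉ S → (Sign.- ◃ j) ∈ S → signIn S j ≡ just Sign.-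
signIn-neg {S} {j} +j∉S -j∈S with (Sign.+ ◃ j) ∈? S | (Sign.- ◃ j) ∈? S
... | yes +j∈S | _       = contradiction +j∈S +j∉S
... | no _     | yes _   = refl
... | no _     | no -j∉S = contradiction -j∈S -j∉S

lemma3p1 : (S : List ℤ) → Signed S → AllNonzero S →
    ∃[ n ] Σ (SignedPerm n) (λ w → PinnacleSetIs w S)
lemma3p1 S signed nonzero = length word , w , λ x → member⇒pinnacle x , pinnacle⇒member x
  where
  N : ℕ
  N = max 0 (map ∣_∣ S)
  open ZigzagWord N (signIn S)
  w : SignedPerm (length word)
  w = signedPerm word ∣word∣↭

  ∣∣≤N : ∀ {x} → x ∈ S → ∣ x ∣ ℕ.≤ N
  ∣∣≤N x∈S = All.lookup (xs≤max 0 (map ∣_∣ S)) (∈-map⁺ ∣_∣ x∈S)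

  member⇒pinnacle : ∀ x → x ∈ S → IsPinnacle w x
  member⇒pinnacle (+ zero) x∈S = contradiction refl (nonzero _ x∈S)
  member⇒pinnacle +[1+ k ] x∈S =
    Pinnacle⇒PinnacleOf-lookup (chosen⇒pinnacle (∣∣≤N x∈S) (signIn-pos x∈S))
  member⇒pinnacle -[1+ k ] x∈S =
    Pinnacle⇒PinnacleOf-lookup (chosen⇒pinnacle (∣∣≤N x∈S) (signIn-neg (signed _ x∈S) x∈S))

  pinnacle⇒member : ∀ x → IsPinnacle w x → x ∈ S
  pinnacle⇒member x p
    with j , _ , eq , refl ← pinnacle⇒chosen (PinnacleOf-lookup⇒Pinnacle word p) = signIn-sound S j eq
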